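{- Let $k\ge 1$ and $n\ge 1$ be integers. If $k=1$, then $f_n(\{n-k\})=2^{n-1}$ and $f_n(\{k\})=2^{n-1}$. If $k>1$ and $n\le k+1$, then $f_n(\{n-k\})=2^{n-1}$ and $f_n(\{k\})=2^{n-1}$. If $k>1$ and $n>k+1$, then $f_n(\{n-k\})=5\cdot 2^{n-3}-2^{n-k-2}$ and $f_n(\{k\})=5\cdot 2^{n-3}-2^{k-2}$.
   Context: The set of alternatives is $[n]=\{1,\dots,n\}$ with its natural order. For a triple $i<j<k'$, the never condition $1N3$ on a set of linear orders means that in every order, $i$ is not ranked last among $i,j,k'$; $3N1$ means that $k'$ is not ranked first among $i,j,k'$. For $B\subseteq[n]$, the set-alternating scheme generated by $B$ assigns to each triple $i<j<k'$ the condition $1N3$ if $j\in B$ and $3N1$ if $j\notin B$; $D_{[n]}(B)$ is the set of all linear orders on $[n]$ satisfying all assigned conditions, and $f_n(B)=|D_{[n]}(B)|$. For a set $B$ of integers not contained in $[n]$, $f_n(B)$ means $f_n(B\cap[n])$. -}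

module Defs where

open import Data.Nat using (ℕ; zero; suc; _+_; _<_; _≤_)
open import Data.List using (List; []; _∷_; _++_; length)
open import Data.List.Membership.Propositional using (_∈_)
open import Data.List.Relation.Unary.All using (All)
open import Data.List.Relation.Unary.Unique.Propositional using (Unique)
open import Data.List.Relation.Binary.Permutation.Propositional using (_↭_)
open import Data.Product using (Σ; _×_; ∃₂)
open import Data.Sum using (_⊎_)
open import Relation.Nullary using (¬_)
open import Relation.Binary.PropositionalEquality using (_≡_)

range : ℕ → List ℕ
range zero    = []
range (suc n) = range n ++ (suc n ∷ [])

-- A linear order on [n] is represented as the list of the alternatives
-- from the top-ranked (first) to the bottom-ranked (last), i.e. any
-- permutation of [n].
LinOrder : ℕ → List ℕ → Set
LinOrder n xs = xs ↭ range n

Above : List ℕ → ℕ → ℕ → Set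
Above xs a b = ∃₂ λ ys zs → (xs ≡ ys ++ (a ∷ zs)) × (b ∈ zs)

-- 1N3 on the triple (i, j, k'): i is not ranked last among i, j, k'.
OneN3 : List ℕ → ℕ → ℕ → ℕ → Set
OneN3 xs i j k' = Above xs i j ⊎ Above xs i k'

-- 3N1 on the triple (i, j, k'): k' is not ranked first among i, j, k'.
ThreeN1 : List ℕ → ℕ → ℕ → ℕ → Set
ThreeN1 xs i j k' = Above xs i k' ⊎ Above xs j k'

-- Membership in the set-alternating domain D_[n](B), where B ⊆ ℕ is
-- given as a predicate (only its trace on [n] matters).
InD : ℕ → (ℕ → Set) → List ℕ → Set
InD n B xs =
  LinOrder n xs ×
  (∀ i j k' → 1 ≤ i → i < j → j < k' → k' ≤ n →
     (B j → OneN3 xs i j k') × (¬ B j → ThreeN1 xs i j k'))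

HasSize : (List ℕ → Set) → ℕ → Set
HasSize P m =
  Σ (List (List ℕ)) λ L →
    (length L ≡ m) × Unique L × All P L × (∀ xs → P xs → xs ∈ L)

fIs : ℕ → (ℕ → Set) → ℕ → Set
fIs n B m = HasSize (InD n B) m

{-# OPTIONS --safe #-}
-- With B = {b}, list each order from the bottom. The largest alternative m is the top
-- of every triple containing it, so deleting m from a valid order on [m] leaves a valid
-- order, and m sits at the bottom, directly above the lowest element y (allowed unless
-- y < b < m), or directly above the two lowest elements y, z (allowed exactly when
-- y = b and z < b): among three elements below m, two differ from b, and 3N1 fails on
-- them and m. So the valid orders on [n] arise by inserting 1, 2, ..., n in turn. Let
-- N be their number, H the number whose lowest element is at least b, and E the number
-- whose two lowest elements are b and some z < b. While n < b, or if b ≤ 1, every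
-- order has exactly two extensions and N doubles; once n ≥ b, N' = N + H + E, H' = N'
-- and E' = E = 2^(b-2). Hence N = 2^(n-1) for n ≤ b + 1 and 5·2^(n-3) - 2^(b-2) beyond.
module Submission where

open import Defs
open import Data.Nat
  using (ℕ; zero; suc; _+_; _*_; _∸_; _^_; _≤_; _<_; _>_; z≤n; s≤s; z<s; _≤?_; _<?_; _≟_)
open import Data.Nat.Properties
open import Data.Nat.ListAction using (sum)
open import Algebra.Properties.CommutativeSemigroup +-commutativeSemigroup
  using () renaming (interchange to +-interchange)
open import Data.Nat.Solver using (module +-*-Solver)
open import Data.List using (List; []; _∷_; _++_; length; map; reverse; [_]; concatMap; filter)
open import Data.List.Properties
  using (length-map; length-++; reverse-involutive; reverse-injective; reverse-++; unfold-reverse;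
         ++-identityʳ; ++-assoc; ∷-injective; filter-++; filter-all; filter-reject)
open import Data.List.Membership.Propositional using (_∈_; find; lose)
open import Data.List.Membership.Propositional.Properties
  using (∈-∃++; ∈-++⁺ˡ; ∈-++⁺ʳ; ∈-++⁻; ∈-map⁺; ∈-map⁻; ∈-concatMap⁺; ∈-concatMap⁻)
open import Data.List.Relation.Unary.Any using (here; there)
open import Data.List.Relation.Unary.Any.Properties using (reverse⁺)
open import Data.List.Relation.Unary.All as All using (All; []; _∷_)
import Data.List.Relation.Unary.All.Properties as AllP
open import Data.List.Relation.Unary.AllPairs using ([]; _∷_)
open import Data.List.Relation.Unary.Unique.Propositional using (Unique)
import Data.List.Relation.Unary.Unique.Propositional.Properties as UniqueP
open import Data.List.Relation.Binary.Permutation.Propositional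
  using (_↭_; ↭-sym; ↭-trans; ↭-refl; ↭-prep; ↭⇒↭ₛ)
open import Data.List.Relation.Binary.Permutation.Propositional.Properties
  using (∈-resp-↭; ↭-length; shift; drop-mid; ↭-reverse; ∷↭∷ʳ)
open import Data.List.Relation.Binary.Permutation.Setoid.Properties using (Unique-resp-↭)
open import Data.Product using (_×_; _,_; proj₁; proj₂; ∃₂; ∃)
open import Data.Sum using (_⊎_; inj₁; inj₂) renaming (map to map⊎)
open import Data.Empty using (⊥; ⊥-elim)
open import Relation.Nullary using (¬_; Dec; yes; no)
open import Relation.Nullary.Decidable using (¬?; _×-dec_)
open import Function using (id; _∘′_)
open import Relation.Binary.Definitions using (tri<; tri≈; tri>)
open import Relation.Binary.PropositionalEquality hiding ([_])

Precedes : List ℕ → ℕ → ℕ → Set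
Precedes []      a c = ⊥
Precedes (x ∷ r) a c = (x ≡ a × c ∈ r) ⊎ Precedes r a c

Precedes-∈ˡ : ∀ r {a c} → Precedes r a c → a ∈ r
Precedes-∈ˡ (x ∷ r) (inj₁ (refl , _)) = here refl
Precedes-∈ˡ (x ∷ r) (inj₂ p)          = there (Precedes-∈ˡ r p)

Precedes-∈ʳ : ∀ r {a c} → Precedes r a c → c ∈ r
Precedes-∈ʳ (x ∷ r) (inj₁ (_ , c∈r)) = there c∈r
Precedes-∈ʳ (x ∷ r) (inj₂ p)         = there (Precedes-∈ʳ r p)

Precedes-++ : ∀ pre {a c post} → c ∈ pre → Precedes (pre ++ a ∷ post) c a
Precedes-++ (x ∷ pre) (here refl) = inj₁ (refl , ∈-++⁺ʳ pre (here refl))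
Precedes-++ (x ∷ pre) (there c∈)  = inj₂ (Precedes-++ pre c∈)

Precedes-split : ∀ r {c a} → Precedes r c a → ∃₂ λ pre post → r ≡ pre ++ a ∷ post × c ∈ pre
Precedes-split (x ∷ r) (inj₁ (refl , a∈r)) with ∈-∃++ a∈r
... | pre , post , eq = x ∷ pre , post , cong (x ∷_) eq , here refl
Precedes-split (x ∷ r) (inj₂ p) with Precedes-split r p
... | pre , post , eq , c∈ = x ∷ pre , post , cong (x ∷_) eq , there c∈

Precedes-asym : ∀ r {a c} → Unique r → Precedes r a c → ¬ Precedes r c a
Precedes-asym (x ∷ r) (x∉ ∷ u) (inj₁ (refl , _)) (inj₁ (refl , a∈r)) = All.lookup x∉ a∈r refl
Precedes-asym (x ∷ r) (x∉ ∷ u) (inj₁ (refl , _)) (inj₂ q)            = All.lookup x∉ (Precedes-∈ʳ r q) refl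
Precedes-asym (x ∷ r) (x∉ ∷ u) (inj₂ p)          (inj₁ (refl , _))   = All.lookup x∉ (Precedes-∈ʳ r p) refl
Precedes-asym (x ∷ r) (x∉ ∷ u) (inj₂ p)          (inj₂ q)            = Precedes-asym r u p q

reverse-++-∷ : ∀ (pre : List ℕ) a post → reverse (pre ++ a ∷ post) ≡ reverse post ++ a ∷ reverse pre
reverse-++-∷ pre a post = begin
  reverse (pre ++ a ∷ post)           ≡⟨ reverse-++ pre (a ∷ post) ⟩
  reverse (a ∷ post) ++ reverse pre   ≡⟨ cong (_++ reverse pre) (unfold-reverse a post) ⟩
  (reverse post ++ [ a ]) ++ reverse pre ≡⟨ ++-assoc (reverse post) [ a ] (reverse pre) ⟩
  reverse post ++ a ∷ reverse pre     ∎
  where open ≡-Reasoning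

Above-reverse⇒Precedes : ∀ r {a c} → Above (reverse r) a c → Precedes r c a
Above-reverse⇒Precedes r {a} {c} (ys , zs , eq , c∈zs) =
  subst (λ l → Precedes l c a) (sym r≡) (Precedes-++ (reverse zs) (reverse⁺ c∈zs))
  where
  r≡ : r ≡ reverse zs ++ a ∷ reverse ys
  r≡ = trans (sym (reverse-involutive r)) (trans (cong reverse eq) (reverse-++-∷ ys a zs))

Precedes⇒Above-reverse : ∀ r {a c} → Precedes r c a → Above (reverse r) a c
Precedes⇒Above-reverse r p with Precedes-split r p
... | pre , post , eq , c∈pre =
  reverse post , reverse pre , trans (cong reverse eq) (reverse-++-∷ pre _ post) , reverse⁺ c∈pre

∈-remove : ∀ pre {m c : ℕ} {post} → c ≢ m → c ∈ pre ++ m ∷ post → c ∈ pre ++ post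
∈-remove []        c≢m (here c≡m) = ⊥-elim (c≢m c≡m)
∈-remove []        c≢m (there c∈) = c∈
∈-remove (x ∷ pre) c≢m (here c≡x) = here c≡x
∈-remove (x ∷ pre) c≢m (there c∈) = there (∈-remove pre c≢m c∈)

∈-insert : ∀ pre {m c : ℕ} {post} → c ∈ pre ++ post → c ∈ pre ++ m ∷ post
∈-insert []        c∈         = there c∈
∈-insert (x ∷ pre) (here c≡x) = here c≡x
∈-insert (x ∷ pre) (there c∈) = there (∈-insert pre c∈)

Precedes-remove : ∀ pre {m a c post} → a ≢ m → c ≢ m →
                  Precedes (pre ++ m ∷ post) a c → Precedes (pre ++ post) a c
Precedes-remove []        a≢m c≢m (inj₁ (m≡a , _))  = ⊥-elim (a≢m (sym m≡a))
Precedes-remove []        a≢m c≢m (inj₂ p)          = p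
Precedes-remove (x ∷ pre) a≢m c≢m (inj₁ (x≡a , c∈)) = inj₁ (x≡a , ∈-remove pre c≢m c∈)
Precedes-remove (x ∷ pre) a≢m c≢m (inj₂ p)          = inj₂ (Precedes-remove pre a≢m c≢m p)

Precedes-insert : ∀ pre {m a c post} → Precedes (pre ++ post) a c → Precedes (pre ++ m ∷ post) a c
Precedes-insert []        p                 = inj₂ p
Precedes-insert (x ∷ pre) (inj₁ (x≡a , c∈)) = inj₁ (x≡a , ∈-insert pre c∈)
Precedes-insert (x ∷ pre) (inj₂ p)          = inj₂ (Precedes-insert pre p)

∈-range⁺ : ∀ n {x} → 1 ≤ x → x ≤ n → x ∈ range n
∈-range⁺ zero    (s≤s _) ()
∈-range⁺ (suc n) {x} 1≤x x≤1+n with m≤n⇒m<n∨m≡n x≤1+n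
... | inj₁ x<1+n = ∈-++⁺ˡ (∈-range⁺ n 1≤x (≤-pred x<1+n))
... | inj₂ refl  = ∈-++⁺ʳ (range n) (here refl)

∈-range⁻ : ∀ n {x} → x ∈ range n → 1 ≤ x × x ≤ n
∈-range⁻ (suc n) x∈ with ∈-++⁻ (range n) x∈
... | inj₁ x∈n       = proj₁ (∈-range⁻ n x∈n) , m≤n⇒m≤1+n (proj₂ (∈-range⁻ n x∈n))
... | inj₂ (here refl) = s≤s z≤n , ≤-refl

range-unique : ∀ n → Unique (range n)
range-unique zero    = []
range-unique (suc n) =
  UniqueP.++⁺ (range-unique n) ([] ∷ []) λ { (x∈ , here refl) → 1+n≰n (proj₂ (∈-range⁻ n x∈)) }

↭-range-insert : ∀ n pre post → pre ++ post ↭ range n → pre ++ suc n ∷ post ↭ range (suc n)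
↭-range-insert n pre post p =
  ↭-trans (shift (suc n) pre post) (↭-trans (↭-prep (suc n) p) (∷↭∷ʳ (suc n) (range n)))

↭-range-remove : ∀ n pre post → pre ++ suc n ∷ post ↭ range (suc n) → pre ++ post ↭ range n
↭-range-remove n pre post p = subst (pre ++ post ↭_) (++-identityʳ (range n)) (drop-mid pre (range n) p)

-- Orders are listed from the bottom, so 1N3 on (i, j, k) says that j or k precedes i,
-- and 3N1 says that k precedes i or j.
TripleCondition : ℕ → List ℕ → ℕ → ℕ → ℕ → Set
TripleCondition b r i j k =
  (j ≡ b → Precedes r j i ⊎ Precedes r k i) × (j ≢ b → Precedes r k i ⊎ Precedes r k j)

Valid : ℕ → ℕ → List ℕ → Set
Valid b n r =
  r ↭ range n × (∀ i j k → 1 ≤ i → i < j → j < k → k ≤ n → TripleCondition b r i j k)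

Valid⇒InD-reverse : ∀ b n r → Valid b n r → InD n (_≡ b) (reverse r)
Valid⇒InD-reverse b n r (r↭ , triples) = ↭-trans (↭-reverse r) r↭ , λ i j k 1≤i i<j j<k k≤n →
  let (if-b , if-not-b) = triples i j k 1≤i i<j j<k k≤n
  in (λ j≡b → map⊎ above above (if-b j≡b)) , (λ j≢b → map⊎ above above (if-not-b j≢b))
  where
  above : ∀ {a c} → Precedes r c a → Above (reverse r) a c
  above = Precedes⇒Above-reverse r

InD⇒Valid-reverse : ∀ b n xs → InD n (_≡ b) xs → Valid b n (reverse xs)
InD⇒Valid-reverse b n xs (xs↭ , triples) = ↭-trans (↭-reverse xs) xs↭ , λ i j k 1≤i i<j j<k k≤n →
  let (if-b , if-not-b) = triples i j k 1≤i i<j j<k k≤n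
  in (λ j≡b → map⊎ below below (if-b j≡b)) , (λ j≢b → map⊎ below below (if-not-b j≢b))
  where
  below : ∀ {a c} → Above xs a c → Precedes (reverse xs) c a
  below = Above-reverse⇒Precedes (reverse xs) ∘′ subst (λ l → Above l _ _) (sym (reverse-involutive xs))

Valid-∈⁻ : ∀ {b n r x} → Valid b n r → x ∈ r → 1 ≤ x × x ≤ n
Valid-∈⁻ {n = n} v x∈r = ∈-range⁻ n (∈-resp-↭ (proj₁ v) x∈r)

Valid-∈⁺ : ∀ {b n r x} → Valid b n r → 1 ≤ x → x ≤ n → x ∈ r
Valid-∈⁺ {n = n} v 1≤x x≤n = ∈-resp-↭ (↭-sym (proj₁ v)) (∈-range⁺ n 1≤x x≤n)

Valid-unique : ∀ {b n r} → Valid b n r → Unique r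
Valid-unique {n = n} v = Unique-resp-↭ (setoid ℕ) (↭⇒↭ₛ (↭-sym (proj₁ v))) (range-unique n)

TripleCondition-transfer : ∀ {b r r' i j k} →
  (∀ {a c} → a ≤ k → c ≤ k → Precedes r a c → Precedes r' a c) →
  i < j → j < k → TripleCondition b r i j k → TripleCondition b r' i j k
TripleCondition-transfer {i = i} {j} {k} f i<j j<k (if-b , if-not-b) =
  (λ j≡b → map⊎ (f j≤k i≤k) (f ≤-refl i≤k) (if-b j≡b)) ,
  (λ j≢b → map⊎ (f ≤-refl i≤k) (f ≤-refl j≤k) (if-not-b j≢b))
  where
  i≤k : i ≤ k
  i≤k = <⇒≤ (<-trans i<j j<k)
  j≤k : j ≤ k
  j≤k = <⇒≤ j<k

TopConditions : ℕ → ℕ → List ℕ → Set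
TopConditions b m r = ∀ i j → 1 ≤ i → i < j → j < m → TripleCondition b r i j m

Valid-insert : ∀ b n pre post → Valid b n (pre ++ post) → TopConditions b (suc n) (pre ++ suc n ∷ post) →
               Valid b (suc n) (pre ++ suc n ∷ post)
Valid-insert b n pre post v top = ↭-range-insert n pre post (proj₁ v) , triples
  where
  triples : ∀ i j k → 1 ≤ i → i < j → j < k → k ≤ suc n →
            TripleCondition b (pre ++ suc n ∷ post) i j k
  triples i j k 1≤i i<j j<k k≤1+n with m≤n⇒m<n∨m≡n k≤1+n
  ... | inj₁ k<1+n = TripleCondition-transfer (λ _ _ → Precedes-insert pre) i<j j<k
                       (proj₂ v i j k 1≤i i<j j<k (≤-pred k<1+n))
  ... | inj₂ refl  = top i j 1≤i i<j j<k

Valid-remove : ∀ b n pre post → Valid b (suc n) (pre ++ suc n ∷ post) → Valid b n (pre ++ post)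
Valid-remove b n pre post v = ↭-range-remove n pre post (proj₁ v) , triples
  where
  triples : ∀ i j k → 1 ≤ i → i < j → j < k → k ≤ n → TripleCondition b (pre ++ post) i j k
  triples i j k 1≤i i<j j<k k≤n =
    TripleCondition-transfer
      (λ a≤k c≤k → Precedes-remove pre (<⇒≢ (s≤s (≤-trans a≤k k≤n)))
                                       (<⇒≢ (s≤s (≤-trans c≤k k≤n))))
      i<j j<k (proj₂ v i j k 1≤i i<j j<k (m≤n⇒m≤1+n k≤n))

-- Generating the valid orders by inserting the maximum

singletonIf : {P A : Set} → Dec P → A → List A
singletonIf (yes _) x = [ x ]
singletonIf (no _)  x = []

CanInsertAt1 : ℕ → ℕ → ℕ → Set
CanInsertAt1 b m y = ¬ (y < b × b < m)

canInsertAt1? : ∀ b m y → Dec (CanInsertAt1 b m y)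
canInsertAt1? b m y = ¬? ((y <? b) ×-dec (b <? m))

CanInsertAt2 : ℕ → ℕ → ℕ → Set
CanInsertAt2 b y z = y ≡ b × z < b

canInsertAt2? : ∀ b y z → Dec (CanInsertAt2 b y z)
canInsertAt2? b y z = (y ≟ b) ×-dec (z <? b)

insertAt1 : ℕ → ℕ → List ℕ → List (List ℕ)
insertAt1 b m []      = []
insertAt1 b m (y ∷ t) = singletonIf (canInsertAt1? b m y) (y ∷ m ∷ t)

insertAt2 : ℕ → ℕ → List ℕ → List (List ℕ)
insertAt2 b m []          = []
insertAt2 b m (y ∷ [])    = []
insertAt2 b m (y ∷ z ∷ t) = singletonIf (canInsertAt2? b y z) (y ∷ z ∷ m ∷ t)

insertions : ℕ → ℕ → List ℕ → List (List ℕ)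
insertions b m r = (m ∷ r) ∷ (insertAt1 b m r ++ insertAt2 b m r)

validOrders : ℕ → ℕ → List (List ℕ)
validOrders b zero    = [ [] ]
validOrders b (suc n) = concatMap (insertions b (suc n)) (validOrders b n)

∈-singletonIf⁺ : {P A : Set} (d : Dec P) {x : A} → P → x ∈ singletonIf d x
∈-singletonIf⁺ (yes _) p = here refl
∈-singletonIf⁺ (no ¬p) p = ⊥-elim (¬p p)

∈-singletonIf⁻ : {P A : Set} (d : Dec P) {x w : A} → w ∈ singletonIf d x → P × w ≡ x
∈-singletonIf⁻ (yes p) (here w≡x) = p , w≡x

∈-insertAt1⁻ : ∀ b m r {w} → w ∈ insertAt1 b m r →
               ∃₂ λ y t → r ≡ y ∷ t × CanInsertAt1 b m y × w ≡ y ∷ m ∷ t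
∈-insertAt1⁻ b m (y ∷ t) w∈ with ∈-singletonIf⁻ (canInsertAt1? b m y) w∈
... | allowed , refl = y , t , refl , allowed , refl

∈-insertAt2⁻ : ∀ b m r {w} → w ∈ insertAt2 b m r →
               ∃₂ λ y z → ∃ λ t → r ≡ y ∷ z ∷ t × CanInsertAt2 b y z × w ≡ y ∷ z ∷ m ∷ t
∈-insertAt2⁻ b m (y ∷ z ∷ t) w∈ with ∈-singletonIf⁻ (canInsertAt2? b y z) w∈
... | allowed , refl = y , z , t , refl , allowed , refl

∈-concatMap⁻′ : {A B : Set} (f : A → List B) {xs : List A} {y : B} →
                y ∈ concatMap f xs → ∃ λ x → x ∈ xs × y ∈ f x
∈-concatMap⁻′ f y∈ = find (∈-concatMap⁻ f y∈)

TopConditions-bottom : ∀ b n post → Valid b n post → TopConditions b (suc n) (suc n ∷ post)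
TopConditions-bottom b n post v i j 1≤i i<j j<m =
  (λ _ → inj₂ (inj₁ (refl , i∈))) , (λ _ → inj₁ (inj₁ (refl , i∈)))
  where
  i∈ : i ∈ post
  i∈ = Valid-∈⁺ v 1≤i (≤-pred (<-trans i<j j<m))

TopConditions-at1 : ∀ b n y t → Valid b n (y ∷ t) → CanInsertAt1 b (suc n) y →
                    TopConditions b (suc n) (y ∷ suc n ∷ t)
TopConditions-at1 b n y t v allowed i j 1≤i i<j j<m with Valid-∈⁺ v 1≤i (≤-pred (<-trans i<j j<m))
... | there i∈t = (λ _ → inj₂ (inj₂ (inj₁ (refl , i∈t)))) , (λ _ → inj₁ (inj₂ (inj₁ (refl , i∈t))))
... | here refl with Valid-∈⁺ v (≤-trans 1≤i (<⇒≤ i<j)) (≤-pred j<m)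
...   | here refl = ⊥-elim (<-irrefl refl i<j)
...   | there j∈t = (λ { refl → ⊥-elim (allowed (i<j , j<m)) }) , (λ _ → inj₂ (inj₂ (inj₁ (refl , j∈t))))

above-lowest-two : ∀ {b n y z t j} → Valid b n (y ∷ z ∷ t) → 1 ≤ j → j ≤ n → j ≢ y → j ≢ z →
                   Precedes (y ∷ z ∷ suc n ∷ t) (suc n) j
above-lowest-two v 1≤j j≤n j≢y j≢z with Valid-∈⁺ v 1≤j j≤n
... | here j≡y          = ⊥-elim (j≢y j≡y)
... | there (here j≡z)  = ⊥-elim (j≢z j≡z)
... | there (there j∈t) = inj₂ (inj₂ (inj₁ (refl , j∈t)))

TopConditions-at2 : ∀ b n y z t → Valid b n (y ∷ z ∷ t) → CanInsertAt2 b y z →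
                    TopConditions b (suc n) (y ∷ z ∷ suc n ∷ t)
TopConditions-at2 b n y z t v (refl , z<b) i j 1≤i i<j j<m with Valid-∈⁺ v 1≤i (≤-pred (<-trans i<j j<m))
... | there (there i∈t) =
  (λ _ → inj₂ (inj₂ (inj₂ (inj₁ (refl , i∈t))))) , (λ _ → inj₁ (inj₂ (inj₂ (inj₁ (refl , i∈t)))))
... | here refl =
  (λ { refl → ⊥-elim (<-irrefl refl i<j) }) ,
  (λ j≢i → inj₂ (above-lowest-two v 1≤j j≤n j≢i (>⇒≢ (<-trans z<b i<j))))
  where
  1≤j : 1 ≤ j
  1≤j = ≤-trans 1≤i (<⇒≤ i<j)
  j≤n : j ≤ n
  j≤n = ≤-pred j<m
... | there (here refl) =
  (λ { refl → inj₁ (inj₁ (refl , here refl)) }) ,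
  (λ j≢y → inj₂ (above-lowest-two v 1≤j j≤n j≢y (>⇒≢ i<j)))
  where
  1≤j : 1 ≤ j
  1≤j = ≤-trans 1≤i (<⇒≤ i<j)
  j≤n : j ≤ n
  j≤n = ≤-pred j<m

insertions-sound : ∀ b n r {w} → Valid b n r → w ∈ insertions b (suc n) r → Valid b (suc n) w
insertions-sound b n r v (here refl) = Valid-insert b n [] r v (TopConditions-bottom b n r v)
insertions-sound b n r v (there w∈) with ∈-++⁻ (insertAt1 b (suc n) r) w∈
... | inj₁ w∈₁ with ∈-insertAt1⁻ b (suc n) r w∈₁
...   | y , t , refl , allowed , refl = Valid-insert b n [ y ] t v (TopConditions-at1 b n y t v allowed)
insertions-sound b n r v (there w∈) | inj₂ w∈₂ with ∈-insertAt2⁻ b (suc n) r w∈₂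
...   | y , z , t , refl , allowed , refl =
  Valid-insert b n (y ∷ z ∷ []) t v (TopConditions-at2 b n y z t v allowed)

validOrders-sound : ∀ b n {r} → r ∈ validOrders b n → Valid b n r
validOrders-sound b zero    (here refl) = ↭-refl , λ { _ _ _ _ _ () z≤n }
validOrders-sound b (suc n) r∈ with ∈-concatMap⁻′ (insertions b (suc n)) r∈
... | r₀ , r₀∈ , r∈ins = insertions-sound b n r₀ (validOrders-sound b n r₀∈) r∈ins

module BelowTop {b n r} (v : Valid b (suc n) r) where

  Precedes-irrefl : ∀ {a} → ¬ Precedes r a a
  Precedes-irrefl p = Precedes-asym r (Valid-unique v) p p

  Precedes⇒≢ : ∀ {a c} → Precedes r a c → a ≢ c
  Precedes⇒≢ p refl = Precedes-irrefl p

  below-top-< : ∀ {c} → Precedes r c (suc n) → c < suc n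
  below-top-< p = ≤∧≢⇒< (proj₂ (Valid-∈⁻ v (Precedes-∈ˡ r p))) (Precedes⇒≢ p)

  below-top-≥1 : ∀ {c} → Precedes r c (suc n) → 1 ≤ c
  below-top-≥1 p = proj₁ (Valid-∈⁻ v (Precedes-∈ˡ r p))

  two-below-top : ∀ {a c} → Precedes r a (suc n) → Precedes r c (suc n) → a < c → c ≢ b → ⊥
  two-below-top a≺m c≺m a<c c≢b
    with proj₂ (proj₂ v _ _ (suc n) (below-top-≥1 a≺m) a<c (below-top-< c≺m) ≤-refl) c≢b
  ... | inj₁ m≺a = Precedes-asym r (Valid-unique v) a≺m m≺a
  ... | inj₂ m≺c = Precedes-asym r (Valid-unique v) c≺m m≺c

  two-below-top′ : ∀ {a c} → Precedes r a (suc n) → Precedes r c (suc n) → a ≢ c → a ≢ b → c ≢ b → ⊥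
  two-below-top′ {a} {c} a≺m c≺m a≢c a≢b c≢b with <-cmp a c
  ... | tri< a<c _ _ = two-below-top a≺m c≺m a<c c≢b
  ... | tri≈ _ a≡c _ = a≢c a≡c
  ... | tri> _ _ c<a = two-below-top c≺m a≺m c<a a≢b

  b-above-smaller-below-top : ∀ {a} → Precedes r a (suc n) → Precedes r a b → a < b → b < suc n → ⊥
  b-above-smaller-below-top a≺m a≺b a<b b<m
    with proj₁ (proj₂ v _ b (suc n) (below-top-≥1 a≺m) a<b b<m ≤-refl) refl
  ... | inj₁ b≺a = Precedes-asym r (Valid-unique v) a≺b b≺a
  ... | inj₂ m≺a = Precedes-asym r (Valid-unique v) a≺m m≺a

insertions-complete : ∀ b n pre post → Valid b (suc n) (pre ++ suc n ∷ post) →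
                      pre ++ suc n ∷ post ∈ insertions b (suc n) (pre ++ post)
insertions-complete b n [] post v = here refl
insertions-complete b n (y ∷ []) post v =
  there (∈-++⁺ˡ (∈-singletonIf⁺ (canInsertAt1? b (suc n) y) allowed))
  where
  open BelowTop v
  y≺m : Precedes (y ∷ suc n ∷ post) y (suc n)
  y≺m = inj₁ (refl , here refl)
  allowed : CanInsertAt1 b (suc n) y
  allowed (y<b , b<m) with Valid-∈⁺ v (≤-trans (below-top-≥1 y≺m) (<⇒≤ y<b)) (<⇒≤ b<m)
  ... | here refl         = <-irrefl refl y<b
  ... | there (here refl) = <-irrefl refl b<m
  ... | there (there b∈)  = b-above-smaller-below-top y≺m (inj₁ (refl , there b∈)) y<b b<m
insertions-complete b n (y ∷ z ∷ []) post v =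
  there (∈-++⁺ʳ (insertAt1 b (suc n) (y ∷ z ∷ post)) (∈-singletonIf⁺ (canInsertAt2? b y z) allowed))
  where
  open BelowTop v
  y≺m : Precedes (y ∷ z ∷ suc n ∷ post) y (suc n)
  y≺m = inj₁ (refl , there (here refl))
  z≺m : Precedes (y ∷ z ∷ suc n ∷ post) z (suc n)
  z≺m = inj₂ (inj₁ (refl , here refl))
  y≺z : Precedes (y ∷ z ∷ suc n ∷ post) y z
  y≺z = inj₁ (refl , here refl)
  allowed : CanInsertAt2 b y z
  allowed with <-cmp y z
  ... | tri≈ _ y≡z _ = ⊥-elim (Precedes⇒≢ y≺z y≡z)
  ... | tri< y<z _ _ with z ≟ b
  ...   | no z≢b    = ⊥-elim (two-below-top y≺m z≺m y<z z≢b)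
  ...   | yes refl  = ⊥-elim (b-above-smaller-below-top y≺m y≺z y<z (below-top-< z≺m))
  allowed | tri> _ _ z<y with y ≟ b
  ...   | no y≢b    = ⊥-elim (two-below-top z≺m y≺m z<y y≢b)
  ...   | yes refl  = refl , z<y
insertions-complete b n (y ∷ z ∷ w ∷ pre) post v = ⊥-elim three-below-top
  where
  r : List ℕ
  r = y ∷ z ∷ w ∷ pre ++ suc n ∷ post
  open BelowTop v
  y≺m : Precedes r y (suc n)
  y≺m = Precedes-++ (y ∷ z ∷ w ∷ pre) (here refl)
  z≺m : Precedes r z (suc n)
  z≺m = Precedes-++ (y ∷ z ∷ w ∷ pre) (there (here refl))
  w≺m : Precedes r w (suc n)
  w≺m = Precedes-++ (y ∷ z ∷ w ∷ pre) (there (there (here refl)))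
  y≢z : y ≢ z
  y≢z = Precedes⇒≢ (inj₁ (refl , here refl))
  y≢w : y ≢ w
  y≢w = Precedes⇒≢ (inj₁ (refl , there (here refl)))
  z≢w : z ≢ w
  z≢w = Precedes⇒≢ (inj₂ (inj₁ (refl , here refl)))
  three-below-top : ⊥
  three-below-top with y ≟ b
  ... | yes refl = two-below-top′ z≺m w≺m z≢w (≢-sym y≢z) (≢-sym y≢w)
  ... | no y≢b with z ≟ b
  ...   | yes refl = two-below-top′ y≺m w≺m y≢w y≢b (≢-sym z≢w)
  ...   | no z≢b   = two-below-top′ y≺m z≺m y≢z y≢b z≢b

validOrders-complete : ∀ b n {r} → Valid b n r → r ∈ validOrders b n
validOrders-complete b zero {[]} v = here refl
validOrders-complete b zero {x ∷ r} v with ↭-length (proj₁ v)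
... | ()
validOrders-complete b (suc n) v with ∈-∃++ (Valid-∈⁺ v (s≤s z≤n) ≤-refl)
... | pre , post , refl =
  ∈-concatMap⁺ (insertions b (suc n))
    (lose (validOrders-complete b n (Valid-remove b n pre post v)) (insertions-complete b n pre post v))

filter-<-insert : ∀ m pre post → All (_< m) (pre ++ post) → filter (_<? m) (pre ++ m ∷ post) ≡ pre ++ post
filter-<-insert m pre post pre++post<m = begin
  filter (_<? m) (pre ++ m ∷ post)
    ≡⟨ filter-++ (_<? m) pre (m ∷ post) ⟩
  filter (_<? m) pre ++ filter (_<? m) (m ∷ post)
    ≡⟨ cong₂ _++_ (filter-all (_<? m) pre<m)
                  (trans (filter-reject (_<? m) (<-irrefl refl)) (filter-all (_<? m) post<m)) ⟩
  pre ++ post ∎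
  where
  open ≡-Reasoning
  pre<m : All (_< m) pre
  pre<m = proj₁ (AllP.++⁻ pre pre++post<m)
  post<m : All (_< m) post
  post<m = proj₂ (AllP.++⁻ pre pre++post<m)

insertions-filter : ∀ b m r → All (_< m) r → ∀ {w} → w ∈ insertions b m r → filter (_<? m) w ≡ r
insertions-filter b m r r<m (here refl) = filter-<-insert m [] r r<m
insertions-filter b m r r<m (there w∈) with ∈-++⁻ (insertAt1 b m r) w∈
... | inj₁ w∈₁ with ∈-insertAt1⁻ b m r w∈₁
...   | y , t , refl , _ , refl = filter-<-insert m [ y ] t r<m
insertions-filter b m r r<m (there w∈) | inj₂ w∈₂ with ∈-insertAt2⁻ b m r w∈₂
...   | y , z , t , refl , _ , refl = filter-<-insert m (y ∷ z ∷ []) t r<m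

singletonIf-unique : {P A : Set} (d : Dec P) (x : A) → Unique (singletonIf d x)
singletonIf-unique (yes _) x = [] ∷ []
singletonIf-unique (no _)  x = []

insertAt1-unique : ∀ b m r → Unique (insertAt1 b m r)
insertAt1-unique b m []      = []
insertAt1-unique b m (y ∷ t) = singletonIf-unique (canInsertAt1? b m y) _

insertAt2-unique : ∀ b m r → Unique (insertAt2 b m r)
insertAt2-unique b m []          = []
insertAt2-unique b m (y ∷ [])    = []
insertAt2-unique b m (y ∷ z ∷ t) = singletonIf-unique (canInsertAt2? b y z) _

insertAt-head-new : ∀ b m r → All (_< m) r → ∀ {w} → w ∈ insertAt1 b m r ++ insertAt2 b m r →
                    m ∷ r ≢ w
insertAt-head-new b m r r<m w∈ m∷r≡w with ∈-++⁻ (insertAt1 b m r) w∈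
... | inj₁ w∈₁ with ∈-insertAt1⁻ b m r w∈₁
...   | y , t , refl , _ , refl = <⇒≢ (All.lookup r<m (here refl)) (sym (proj₁ (∷-injective m∷r≡w)))
insertAt-head-new b m r r<m w∈ m∷r≡w | inj₂ w∈₂ with ∈-insertAt2⁻ b m r w∈₂
...   | y , z , t , refl , _ , refl = <⇒≢ (All.lookup r<m (here refl)) (sym (proj₁ (∷-injective m∷r≡w)))

insertAt1-insertAt2-disjoint : ∀ b m r → All (_< m) r →
                               ∀ {w} → ¬ (w ∈ insertAt1 b m r × w ∈ insertAt2 b m r)
insertAt1-insertAt2-disjoint b m r r<m (w∈₁ , w∈₂) with ∈-insertAt1⁻ b m r w∈₁ | ∈-insertAt2⁻ b m r w∈₂
... | _ , _ , _ , _ , refl | y , z , t , refl , _ , w≡ =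
  <⇒≢ (All.lookup r<m (there (here refl))) (sym (proj₁ (∷-injective (proj₂ (∷-injective w≡)))))

insertions-unique : ∀ b m r → All (_< m) r → Unique (insertions b m r)
insertions-unique b m r r<m =
  All.tabulate (insertAt-head-new b m r r<m)
  ∷ UniqueP.++⁺ (insertAt1-unique b m r) (insertAt2-unique b m r) (insertAt1-insertAt2-disjoint b m r r<m)

concatMap-unique : {A B : Set} (f : A → List B) (key : B → A) {xs : List A} → Unique xs →
                   (∀ {x} → x ∈ xs → Unique (f x)) → (∀ {x y} → x ∈ xs → y ∈ f x → key y ≡ x) →
                   Unique (concatMap f xs)
concatMap-unique f key {[]}     []         f-unique key-inv = []
concatMap-unique f key {x ∷ xs} (x∉ ∷ xs!) f-unique key-inv =
  UniqueP.++⁺ (f-unique (here refl))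
    (concatMap-unique f key xs! (f-unique ∘′ there) (key-inv ∘′ there)) disjoint
  where
  disjoint : ∀ {y} → ¬ (y ∈ f x × y ∈ concatMap f xs)
  disjoint (y∈fx , y∈rest) with ∈-concatMap⁻′ f y∈rest
  ... | x′ , x′∈xs , y∈fx′ =
    All.lookup x∉ x′∈xs (trans (sym (key-inv (here refl) y∈fx)) (key-inv (there x′∈xs) y∈fx′))

validOrders-bounded : ∀ b n {r} → r ∈ validOrders b n → All (_< suc n) r
validOrders-bounded b n r∈ = All.tabulate λ x∈r → s≤s (proj₂ (Valid-∈⁻ (validOrders-sound b n r∈) x∈r))

validOrders-unique : ∀ b n → Unique (validOrders b n)
validOrders-unique b zero    = [] ∷ []
validOrders-unique b (suc n) =
  concatMap-unique (insertions b (suc n)) (filter (_<? suc n)) (validOrders-unique b n)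
    (λ r∈ → insertions-unique b (suc n) _ (validOrders-bounded b n r∈))
    (λ r∈ → insertions-filter b (suc n) _ (validOrders-bounded b n r∈))

validOrders-size : ∀ b n → fIs n (_≡ b) (length (validOrders b n))
validOrders-size b n =
  map reverse (validOrders b n) , length-map reverse (validOrders b n) ,
  UniqueP.map⁺ reverse-injective (validOrders-unique b n) , All.tabulate in-domain , complete
  where
  in-domain : ∀ {xs} → xs ∈ map reverse (validOrders b n) → InD n (_≡ b) xs
  in-domain xs∈ with ∈-map⁻ reverse xs∈
  ... | r , r∈ , refl = Valid⇒InD-reverse b n r (validOrders-sound b n r∈)
  complete : ∀ xs → InD n (_≡ b) xs → xs ∈ map reverse (validOrders b n)
  complete xs d = subst (_∈ map reverse (validOrders b n)) (reverse-involutive xs)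
    (∈-map⁺ reverse (validOrders-complete b n (InD⇒Valid-reverse b n xs d)))

-- Counting

sum-map-++ : {A : Set} (g : A → ℕ) (xs ys : List A) → sum (map g (xs ++ ys)) ≡ sum (map g xs) + sum (map g ys)
sum-map-++ g []       ys = refl
sum-map-++ g (x ∷ xs) ys = trans (cong (g x +_) (sum-map-++ g xs ys)) (sym (+-assoc (g x) _ _))

sum-map-concatMap : {A B : Set} (g : B → ℕ) (f : A → List B) (xs : List A) →
                    sum (map g (concatMap f xs)) ≡ sum (map (λ x → sum (map g (f x))) xs)
sum-map-concatMap g f []       = refl
sum-map-concatMap g f (x ∷ xs) =
  trans (sum-map-++ g (f x) (concatMap f xs)) (cong (_ +_) (sum-map-concatMap g f xs))

length-concatMap : {A B : Set} (f : A → List B) (xs : List A) →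
                   length (concatMap f xs) ≡ sum (map (λ x → length (f x)) xs)
length-concatMap f []       = refl
length-concatMap f (x ∷ xs) = trans (length-++ (f x)) (cong (length (f x) +_) (length-concatMap f xs))

sum-map-cong : {A : Set} {g h : A → ℕ} (xs : List A) → (∀ {x} → x ∈ xs → g x ≡ h x) →
               sum (map g xs) ≡ sum (map h xs)
sum-map-cong []       g≡h = refl
sum-map-cong (x ∷ xs) g≡h = cong₂ _+_ (g≡h (here refl)) (sum-map-cong xs (g≡h ∘′ there))

sum-map-+ : {A : Set} (g h : A → ℕ) (xs : List A) →
            sum (map (λ x → g x + h x) xs) ≡ sum (map g xs) + sum (map h xs)
sum-map-+ g h []       = refl
sum-map-+ g h (x ∷ xs) = trans (cong ((g x + h x) +_) (sum-map-+ g h xs)) (+-interchange (g x) (h x) _ _)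

sum-map-const : {A : Set} (g : A → ℕ) (xs : List A) (k : ℕ) → (∀ {x} → x ∈ xs → g x ≡ k) →
                sum (map g xs) ≡ k * length xs
sum-map-const g []       k g≡k = sym (*-zeroʳ k)
sum-map-const g (x ∷ xs) k g≡k =
  trans (cong₂ _+_ (g≡k (here refl)) (sum-map-const g xs k (g≡k ∘′ there))) (sym (*-suc k (length xs)))

sum-map-1 : {A : Set} (g : A → ℕ) (xs : List A) → (∀ {x} → x ∈ xs → g x ≡ 1) →
            sum (map g xs) ≡ length xs
sum-map-1 g xs g≡1 = trans (sum-map-const g xs 1 g≡1) (*-identityˡ (length xs))

indicator : {P : Set} → Dec P → ℕ
indicator (yes _) = 1
indicator (no _)  = 0

indicator-yes : {P : Set} (d : Dec P) → P → indicator d ≡ 1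
indicator-yes (yes _) p = refl
indicator-yes (no ¬p) p = ⊥-elim (¬p p)

indicator-no : {P : Set} (d : Dec P) → ¬ P → indicator d ≡ 0
indicator-no (yes p) ¬p = ⊥-elim (¬p p)
indicator-no (no _)  ¬p = refl

indicator-cong : {P Q : Set} (d : Dec P) (e : Dec Q) → (P → Q) → (Q → P) → indicator d ≡ indicator e
indicator-cong (yes p) (yes q) P⇒Q Q⇒P = refl
indicator-cong (yes p) (no ¬q) P⇒Q Q⇒P = ⊥-elim (¬q (P⇒Q p))
indicator-cong (no ¬p) (yes q) P⇒Q Q⇒P = ⊥-elim (¬p (Q⇒P q))
indicator-cong (no ¬p) (no ¬q) P⇒Q Q⇒P = refl

length-singletonIf : {P A : Set} (d : Dec P) (x : A) → length (singletonIf d x) ≡ indicator d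
length-singletonIf (yes _) x = refl
length-singletonIf (no _)  x = refl

-- The number of admissible insertions of a new maximum directly above the lowest
-- element of r (provided that maximum exceeds b), resp. the two lowest elements.
slot₁ : ℕ → List ℕ → ℕ
slot₁ b []      = 0
slot₁ b (y ∷ _) = indicator (b ≤? y)

slot₂ : ℕ → List ℕ → ℕ
slot₂ b []          = 0
slot₂ b (y ∷ [])    = 0
slot₂ b (y ∷ z ∷ _) = indicator (canInsertAt2? b y z)

length-insertAt1 : ∀ b m r → b < m → length (insertAt1 b m r) ≡ slot₁ b r
length-insertAt1 b m []      b<m = refl
length-insertAt1 b m (y ∷ t) b<m = trans (length-singletonIf (canInsertAt1? b m y) _)
  (indicator-cong (canInsertAt1? b m y) (b ≤? y) (λ allowed → ≮⇒≥ (λ y<b → allowed (y<b , b<m)))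
                                                  (λ b≤y (y<b , _) → <⇒≱ y<b b≤y))

length-insertAt2 : ∀ b m r → length (insertAt2 b m r) ≡ slot₂ b r
length-insertAt2 b m []          = refl
length-insertAt2 b m (y ∷ [])    = refl
length-insertAt2 b m (y ∷ z ∷ t) = length-singletonIf (canInsertAt2? b y z) _

length-insertions : ∀ b m r → b < m → length (insertions b m r) ≡ suc (slot₁ b r + slot₂ b r)
length-insertions b m r b<m =
  cong suc (trans (length-++ (insertAt1 b m r)) (cong₂ _+_ (length-insertAt1 b m r b<m) (length-insertAt2 b m r)))

sum-map-insertions : ∀ (g : List ℕ → ℕ) b m r →
  sum (map g (insertions b m r)) ≡ g (m ∷ r) + (sum (map g (insertAt1 b m r)) + sum (map g (insertAt2 b m r)))
sum-map-insertions g b m r = cong (g (m ∷ r) +_) (sum-map-++ g (insertAt1 b m r) (insertAt2 b m r))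

slot₂-head-≢ : ∀ b y t → y ≢ b → slot₂ b (y ∷ t) ≡ 0
slot₂-head-≢ b y []      y≢b = refl
slot₂-head-≢ b y (z ∷ t) y≢b = indicator-no (canInsertAt2? b y z) (y≢b ∘′ proj₁)

slot₁-insertions : ∀ b m r → b < m → ∀ {w} → w ∈ insertions b m r → slot₁ b w ≡ 1
slot₁-insertions b m r b<m (here refl) = indicator-yes (b ≤? m) (<⇒≤ b<m)
slot₁-insertions b m r b<m (there w∈) with ∈-++⁻ (insertAt1 b m r) w∈
... | inj₁ w∈₁ with ∈-insertAt1⁻ b m r w∈₁
...   | y , t , _ , allowed , refl = indicator-yes (b ≤? y) (≮⇒≥ (λ y<b → allowed (y<b , b<m)))
slot₁-insertions b m r b<m (there w∈) | inj₂ w∈₂ with ∈-insertAt2⁻ b m r w∈₂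
...   | y , z , t , _ , (refl , _) , refl = indicator-yes (b ≤? b) ≤-refl

slot₂-insertions : ∀ b m r → b < m → sum (map (slot₂ b) (insertions b m r)) ≡ slot₂ b r
slot₂-insertions b m r b<m = begin
  sum (map (slot₂ b) (insertions b m r))
    ≡⟨ sum-map-insertions (slot₂ b) b m r ⟩
  slot₂ b (m ∷ r) + (sum (map (slot₂ b) (insertAt1 b m r)) + sum (map (slot₂ b) (insertAt2 b m r)))
    ≡⟨ cong₂ _+_ (slot₂-head-≢ b m r (>⇒≢ b<m))
         (cong₂ _+_ (sum-map-const (slot₂ b) (insertAt1 b m r) 0 above-top)
                    (sum-map-1 (slot₂ b) (insertAt2 b m r) at2)) ⟩
  length (insertAt2 b m r)
    ≡⟨ length-insertAt2 b m r ⟩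
  slot₂ b r ∎
  where
  open ≡-Reasoning
  above-top : ∀ {w} → w ∈ insertAt1 b m r → slot₂ b w ≡ 0
  above-top w∈ with ∈-insertAt1⁻ b m r w∈
  ... | y , t , _ , _ , refl = indicator-no (canInsertAt2? b y m) (λ (_ , m<b) → <-asym m<b b<m)
  at2 : ∀ {w} → w ∈ insertAt2 b m r → slot₂ b w ≡ 1
  at2 w∈ with ∈-insertAt2⁻ b m r w∈
  ... | y , z , t , _ , allowed , refl = indicator-yes (canInsertAt2? b y z) allowed

length-insertions-early : ∀ b n r → Valid b n r → 1 ≤ n → suc n ≤ b → length (insertions b (suc n) r) ≡ 2
length-insertions-early b n [] v 1≤n _ with Valid-∈⁺ v ≤-refl 1≤n
... | ()
length-insertions-early b n (y ∷ t) v 1≤n n<b =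
  cong suc (trans (length-++ (insertAt1 b (suc n) (y ∷ t))) (cong₂ _+_
    (trans (length-singletonIf (canInsertAt1? b (suc n) y) _)
           (indicator-yes (canInsertAt1? b (suc n) y) (λ (_ , b<m) → <⇒≱ b<m n<b)))
    (trans (length-insertAt2 b (suc n) (y ∷ t))
           (slot₂-head-≢ b y t (<⇒≢ (≤-<-trans (proj₂ (Valid-∈⁻ v (here refl))) n<b))))))

length-insertions-b≤1 : ∀ b n r → Valid b n r → 1 ≤ n → b ≤ 1 → length (insertions b (suc n) r) ≡ 2
length-insertions-b≤1 b n [] v 1≤n _ with Valid-∈⁺ v ≤-refl 1≤n
... | ()
length-insertions-b≤1 b n (y ∷ t) v 1≤n b≤1 =
  trans (length-insertions b (suc n) (y ∷ t) (s≤s (≤-trans b≤1 1≤n)))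
    (cong suc (cong₂ _+_ (indicator-yes (b ≤? y) (≤-trans b≤1 (≥1 (here refl)))) (no-slot₂ t (≥1 ∘′ there))))
  where
  ≥1 : ∀ {x} → x ∈ y ∷ t → 1 ≤ x
  ≥1 x∈ = proj₁ (Valid-∈⁻ v x∈)
  no-slot₂ : ∀ t → (∀ {x} → x ∈ t → 1 ≤ x) → slot₂ b (y ∷ t) ≡ 0
  no-slot₂ []      _   = refl
  no-slot₂ (z ∷ _) t≥1 =
    indicator-no (canInsertAt2? b y z) (λ (_ , z<b) → <⇒≱ z<b (≤-trans b≤1 (t≥1 (here refl))))

∉-insertAt2-top : ∀ n r → Valid (suc n) n r → ∀ {w} → ¬ w ∈ insertAt2 (suc n) (suc n) r
∉-insertAt2-top n r v w∈ with ∈-insertAt2⁻ (suc n) (suc n) r w∈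
... | y , z , t , refl , (refl , _) , _ = 1+n≰n (proj₂ (Valid-∈⁻ v (here refl)))

slot₁-insertions-top : ∀ n r → Valid (suc n) n r →
                       sum (map (slot₁ (suc n)) (insertions (suc n) (suc n) r)) ≡ 1
slot₁-insertions-top n r v = trans (sum-map-insertions (slot₁ m) m m r)
  (cong₂ _+_ (indicator-yes (m ≤? m) ≤-refl)
    (cong₂ _+_ (sum-map-const (slot₁ m) (insertAt1 m m r) 0 above-top)
               (sum-map-const (slot₁ m) (insertAt2 m m r) 0 (⊥-elim ∘′ ∉-insertAt2-top n r v))))
  where
  m : ℕ
  m = suc n
  above-top : ∀ {w} → w ∈ insertAt1 m m r → slot₁ m w ≡ 0
  above-top w∈ with ∈-insertAt1⁻ m m r w∈
  ... | y , t , refl , _ , refl =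
    indicator-no (m ≤? y) (λ m≤y → 1+n≰n (≤-trans m≤y (proj₂ (Valid-∈⁻ v (here refl)))))

slot₂-insertions-top : ∀ n r → Valid (suc n) n r → 1 ≤ n →
                       sum (map (slot₂ (suc n)) (insertions (suc n) (suc n) r)) ≡ 1
slot₂-insertions-top n [] v 1≤n with Valid-∈⁺ v ≤-refl 1≤n
... | ()
slot₂-insertions-top n (z ∷ t) v 1≤n = trans (sum-map-insertions (slot₂ m) m m (z ∷ t))
  (cong₂ _+_ (indicator-yes (canInsertAt2? m m z) (refl , s≤s (proj₂ (Valid-∈⁻ v (here refl)))))
    (cong₂ _+_ (sum-map-const (slot₂ m) (insertAt1 m m (z ∷ t)) 0 above-top)
               (sum-map-const (slot₂ m) (insertAt2 m m (z ∷ t)) 0 (⊥-elim ∘′ ∉-insertAt2-top n (z ∷ t) v))))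
  where
  m : ℕ
  m = suc n
  above-top : ∀ {w} → w ∈ insertAt1 m m (z ∷ t) → slot₂ m w ≡ 0
  above-top w∈ with ∈-insertAt1⁻ m m (z ∷ t) w∈
  ... | y , _ , _ , _ , refl = indicator-no (canInsertAt2? m y m) (λ (_ , m<m) → <-irrefl refl m<m)

count slots₁ slots₂ : ℕ → ℕ → ℕ
count b n  = length (validOrders b n)
slots₁ b n = sum (map (slot₁ b) (validOrders b n))
slots₂ b n = sum (map (slot₂ b) (validOrders b n))

count-doubles : ∀ b n → (∀ {r} → Valid b n r → length (insertions b (suc n) r) ≡ 2) →
                count b (suc n) ≡ 2 * count b n
count-doubles b n two = trans (length-concatMap (insertions b (suc n)) (validOrders b n))
  (sum-map-const _ (validOrders b n) 2 (two ∘′ validOrders-sound b n))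

count-suc : ∀ b n → b ≤ n → count b (suc n) ≡ count b n + (slots₁ b n + slots₂ b n)
count-suc b n b≤n = begin
  count b (suc n)
    ≡⟨ length-concatMap (insertions b (suc n)) orders ⟩
  sum (map (λ r → length (insertions b (suc n) r)) orders)
    ≡⟨ sum-map-cong orders (λ {r} _ → length-insertions b (suc n) r (s≤s b≤n)) ⟩
  sum (map (λ r → 1 + (slot₁ b r + slot₂ b r)) orders)
    ≡⟨ sum-map-+ (λ _ → 1) (λ r → slot₁ b r + slot₂ b r) orders ⟩
  sum (map (λ _ → 1) orders) + sum (map (λ r → slot₁ b r + slot₂ b r) orders)
    ≡⟨ cong₂ _+_ (sum-map-1 (λ _ → 1) orders (λ _ → refl)) (sum-map-+ (slot₁ b) (slot₂ b) orders) ⟩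
  count b n + (slots₁ b n + slots₂ b n) ∎
  where
  open ≡-Reasoning
  orders : List (List ℕ)
  orders = validOrders b n

slots₁-suc : ∀ b n → b ≤ n → slots₁ b (suc n) ≡ count b (suc n)
slots₁-suc b n b≤n = begin
  slots₁ b (suc n)
    ≡⟨ sum-map-concatMap (slot₁ b) (insertions b (suc n)) (validOrders b n) ⟩
  sum (map (λ r → sum (map (slot₁ b) (insertions b (suc n) r))) (validOrders b n))
    ≡⟨ sum-map-cong (validOrders b n) (λ {r} _ →
         sum-map-1 (slot₁ b) (insertions b (suc n) r) (slot₁-insertions b (suc n) r (s≤s b≤n))) ⟩
  sum (map (λ r → length (insertions b (suc n) r)) (validOrders b n))
    ≡⟨ length-concatMap (insertions b (suc n)) (validOrders b n) ⟨
  count b (suc n) ∎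
  where open ≡-Reasoning

slots₂-suc : ∀ b n → b ≤ n → slots₂ b (suc n) ≡ slots₂ b n
slots₂-suc b n b≤n = trans (sum-map-concatMap (slot₂ b) (insertions b (suc n)) (validOrders b n))
  (sum-map-cong (validOrders b n) (λ {r} _ → slot₂-insertions b (suc n) r (s≤s b≤n)))

slots₁-top : ∀ n → slots₁ (suc n) (suc n) ≡ count (suc n) n
slots₁-top n =
  trans (sum-map-concatMap (slot₁ (suc n)) (insertions (suc n) (suc n)) (validOrders (suc n) n))
    (sum-map-1 _ (validOrders (suc n) n) (λ {r} r∈ → slot₁-insertions-top n r (validOrders-sound (suc n) n r∈)))

slots₂-top : ∀ n → 1 ≤ n → slots₂ (suc n) (suc n) ≡ count (suc n) n
slots₂-top n 1≤n =
  trans (sum-map-concatMap (slot₂ (suc n)) (insertions (suc n) (suc n)) (validOrders (suc n) n))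
    (sum-map-1 _ (validOrders (suc n) n)
      (λ {r} r∈ → slot₂-insertions-top n r (validOrders-sound (suc n) n r∈) 1≤n))

-- Solving the recurrences

count-doubling : ∀ b n → 1 ≤ n → b ≤ 1 ⊎ n ≤ b → count b n ≡ 2 ^ (n ∸ 1)
count-doubling b (suc zero)    _ _     = refl
count-doubling b (suc (suc n)) _ phase =
  trans (count-doubles b (suc n) (two-insertions phase))
        (cong (2 *_) (count-doubling b (suc n) (s≤s z≤n) (map⊎ id (≤-trans (n≤1+n _)) phase)))
  where
  two-insertions : b ≤ 1 ⊎ 2 + n ≤ b → ∀ {r} → Valid b (suc n) r → length (insertions b (2 + n) r) ≡ 2
  two-insertions (inj₁ b≤1)   v = length-insertions-b≤1 b (suc n) _ v (s≤s z≤n) b≤1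
  two-insertions (inj₂ 2+n≤b) v = length-insertions-early b (suc n) _ v (s≤s z≤n) 2+n≤b

count-early : ∀ c → count (2 + c) (1 + c) ≡ 2 ^ c
count-early c = count-doubling (2 + c) (1 + c) (s≤s z≤n) (inj₂ (n≤1+n _))

count-top : ∀ c → count (2 + c) (3 + c) ≡ 2 ^ (2 + c)
count-top c = begin
  count b (3 + c)                                     ≡⟨ count-suc b (2 + c) ≤-refl ⟩
  count b (2 + c) + (slots₁ b (2 + c) + slots₂ b (2 + c))
    ≡⟨ cong₂ _+_ (count-doubling b (2 + c) (s≤s z≤n) (inj₂ ≤-refl))
                 (cong₂ _+_ (trans (slots₁-top (1 + c)) (count-early c))
                            (trans (slots₂-top (1 + c) (s≤s z≤n)) (count-early c))) ⟩
  2 * 2 ^ c + (2 ^ c + 2 ^ c)                         ≡⟨ quadruple (2 ^ c) ⟩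
  2 * (2 * 2 ^ c)                                     ∎
  where
  b : ℕ
  b = 2 + c
  open ≡-Reasoning
  open +-*-Solver
  quadruple : ∀ x → 2 * x + (x + x) ≡ 2 * (2 * x)
  quadruple = solve 1 (λ x → con 2 :* x :+ (x :+ x) := con 2 :* (con 2 :* x)) refl

slots₂-stable : ∀ c n → 2 + c ≤ n → slots₂ (2 + c) n ≡ 2 ^ c
slots₂-stable c (suc n) b≤1+n with m≤n⇒m<n∨m≡n b≤1+n
... | inj₂ refl = trans (slots₂-top (1 + c) (s≤s z≤n)) (count-early c)
... | inj₁ b<1+n = trans (slots₂-suc (2 + c) n (≤-pred b<1+n)) (slots₂-stable c n (≤-pred b<1+n))

count-late : ∀ c q → c ≤ q → count (2 + c) (3 + q) + 2 ^ c ≡ 5 * 2 ^ q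
count-late c q c≤q with m≤n⇒m<n∨m≡n c≤q
... | inj₂ refl = trans (cong (_+ 2 ^ c) (count-top c)) (quintuple (2 ^ c))
  where
  open +-*-Solver
  quintuple : ∀ x → 2 * (2 * x) + x ≡ 5 * x
  quintuple = solve 1 (λ x → con 2 :* (con 2 :* x) :+ x := con 5 :* x) refl
count-late c (suc q) _ | inj₁ (s≤s c≤q) = begin
  count b (4 + q) + 2 ^ c
    ≡⟨ cong (_+ 2 ^ c) (count-suc b (3 + q) b≤3+q) ⟩
  count b (3 + q) + (slots₁ b (3 + q) + slots₂ b (3 + q)) + 2 ^ c
    ≡⟨ cong (λ s → count b (3 + q) + s + 2 ^ c)
            (cong₂ _+_ (slots₁-suc b (2 + q) (s≤s (s≤s c≤q))) (slots₂-stable c (3 + q) b≤3+q)) ⟩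
  count b (3 + q) + (count b (3 + q) + 2 ^ c) + 2 ^ c
    ≡⟨ regroup (count b (3 + q)) (2 ^ c) ⟩
  (count b (3 + q) + 2 ^ c) + (count b (3 + q) + 2 ^ c)
    ≡⟨ cong (λ s → s + s) (count-late c q c≤q) ⟩
  5 * 2 ^ q + 5 * 2 ^ q
    ≡⟨ double (2 ^ q) ⟩
  5 * 2 ^ (1 + q) ∎
  where
  b : ℕ
  b = 2 + c
  b≤3+q : b ≤ 3 + q
  b≤3+q = s≤s (s≤s (m≤n⇒m≤1+n c≤q))
  open ≡-Reasoning
  open +-*-Solver
  regroup : ∀ a x → a + (a + x) + x ≡ (a + x) + (a + x)
  regroup = solve 2 (λ a x → a :+ (a :+ x) :+ x := (a :+ x) :+ (a :+ x)) refl
  double : ∀ x → 5 * x + 5 * x ≡ 5 * (2 * x)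
  double = solve 1 (λ x → con 5 :* x :+ con 5 :* x := con 5 :* (con 2 :* x)) refl

count-closed-early : ∀ b n → 1 ≤ n → b ≤ 1 ⊎ n ≤ suc b → count b n ≡ 2 ^ (n ∸ 1)
count-closed-early b n 1≤n (inj₁ b≤1) = count-doubling b n 1≤n (inj₁ b≤1)
count-closed-early b n 1≤n (inj₂ n≤1+b) with m≤n⇒m<n∨m≡n n≤1+b
... | inj₁ n<1+b = count-doubling b n 1≤n (inj₂ (≤-pred n<1+b))
... | inj₂ refl with b ≤? 1
...   | yes b≤1 = count-doubling b n 1≤n (inj₁ b≤1)
...   | no b≰1 with ≰⇒> b≰1
...     | s≤s (s≤s {n = c} z≤n) = count-top c

count-closed-late : ∀ b n → 2 ≤ b → b < n → count b n ≡ 5 * 2 ^ (n ∸ 3) ∸ 2 ^ (b ∸ 2)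
count-closed-late (suc (suc c)) (suc (suc (suc q))) (s≤s (s≤s z≤n)) (s≤s (s≤s (s≤s c≤q))) =
  trans (sym (m+n∸n≡m (count (2 + c) (3 + q)) (2 ^ c))) (cong (_∸ 2 ^ c) (count-late c q c≤q))

mainTheorem9 : (k n : ℕ) → 1 ≤ k → 1 ≤ n →
    (k ≡ 1 →
      fIs n (λ j → j ≡ n ∸ k) (2 ^ (n ∸ 1)) × fIs n (λ j → j ≡ k) (2 ^ (n ∸ 1)))
    × (k > 1 → n ≤ k + 1 →
      fIs n (λ j → j ≡ n ∸ k) (2 ^ (n ∸ 1)) × fIs n (λ j → j ≡ k) (2 ^ (n ∸ 1)))
    × (k > 1 → n > k + 1 →
      fIs n (λ j → j ≡ n ∸ k) (5 * 2 ^ (n ∸ 3) ∸ 2 ^ (n ∸ k ∸ 2))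
      × fIs n (λ j → j ≡ k) (5 * 2 ^ (n ∸ 3) ∸ 2 ^ (k ∸ 2)))
mainTheorem9 k n 1≤k 1≤n =
  (λ { refl → fIs-count (n ∸ 1) (count-closed-early (n ∸ 1) n 1≤n (inj₂ (m≤n+m∸n n 1)))
            , fIs-count 1 (count-closed-early 1 n 1≤n (inj₁ ≤-refl)) }) ,
  (λ _ n≤k+1 → fIs-count (n ∸ k) (count-closed-early (n ∸ k) n 1≤n (inj₁ (m≤n+o⇒m∸n≤o n k n≤k+1)))
             , fIs-count k (count-closed-early k n 1≤n (inj₂ (subst (n ≤_) (+-comm k 1) n≤k+1)))) ,
  (λ 2≤k k+1<n → fIs-count (n ∸ k) (count-closed-late (n ∸ k) n (2≤n∸k k+1<n) (∸-monoʳ-< 1≤k (k≤n k+1<n)))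
               , fIs-count k (count-closed-late k n 2≤k (<-trans (m<m+n k z<s) k+1<n)))
  where
  fIs-count : ∀ b {m} → count b n ≡ m → fIs n (_≡ b) m
  fIs-count b count≡m = subst (fIs n (_≡ b)) count≡m (validOrders-size b n)
  k≤n : k + 1 < n → k ≤ n
  k≤n k+1<n = m+n≤o⇒m≤o k (<⇒≤ k+1<n)
  2≤n∸k : k + 1 < n → 2 ≤ n ∸ k
  2≤n∸k k+1<n = m+n≤o⇒m≤o∸n 2 (subst (_≤ n) (cong suc (+-comm k 1)) k+1<n)
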